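{- For every $m\in\mathbb{N}$ there exist a graph $G$ with $\mathrm{tw}(G)\le m$ and a non-piercing family $\mathcal{H}$ of subgraphs of $G$ such that every dual support $Q^*$ for $(G,\mathcal{H})$ satisfies $\mathrm{tw}(Q^*)\ge \frac{2^{\lfloor m/2\rfloor}}{\sqrt{m}}$.
   Context: Subgraphs are identified with their vertex sets (induced subgraphs). A family $\mathcal{H}$ of connected subgraphs of $G$ is non-piercing if for all $H,H'\in\mathcal{H}$ the subgraph of $G$ induced on $V(H)\setminus V(H')$ is connected. A dual support for $(G,\mathcal{H})$ is a graph $Q^*$ with vertex set $\mathcal{H}$ such that for each $v\in V(G)$, $\{H\in\mathcal{H}: v\in V(H)\}$ induces a connected subgraph of $Q^*$. $\mathrm{tw}$ denotes treewidth. -}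

module Defs where

open import Data.Nat using (ℕ; zero; suc; _≤_; _+_)
open import Data.Fin using (Fin; zero; suc; inject₁; fromℕ)
open import Data.Fin.Subset using (Subset; _∈_; _∉_; ∣_∣)
open import Data.Bool using (Bool; T)
open import Data.Product using (Σ; _×_; ∃; ∃-syntax)
open import Relation.Binary.PropositionalEquality using (_≡_)
open import Relation.Nullary using (¬_)

record Graph (n : ℕ) : Set where
  field
    adj    : Fin n → Fin n → Bool
    sym    : ∀ u v → adj u v ≡ adj v u
    irrefl : ∀ u → adj u u ≡ Data.Bool.false

open Graph public

E : ∀ {n} → Graph n → Fin n → Fin n → Set
E G u v = T (adj G u v)

data WalkIn {n} (G : Graph n) (S : Fin n → Set) : Fin n → Fin n → Set where
  here : ∀ {u} → S u → WalkIn G S u u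
  step : ∀ {u w v} → S u → E G u w → WalkIn G S w v → WalkIn G S u v

-- The subgraph induced on the vertices satisfying S is connected
-- (the empty vertex set counts as connected).
ConnectedOn : ∀ {n} → Graph n → (Fin n → Set) → Set
ConnectedOn G S = ∀ u v → S u → S v → WalkIn G S u v

record Cycle {n} (G : Graph n) : Set where
  field
    l     : ℕ
    c     : Fin (3 + l) → Fin n
    inj   : ∀ i j → c i ≡ c j → i ≡ j
    edges : ∀ (i : Fin (2 + l)) → E G (c (inject₁ i)) (c (suc i))
    close : E G (c (fromℕ (2 + l))) (c zero)

IsTree : ∀ {k} → Graph k → Set
IsTree {k} T' = (1 ≤ k) × ConnectedOn T' (λ _ → Data.Unit.⊤) × ¬ Cycle T'
  where import Data.Unit

record TreeDecomposition {n} (G : Graph n) : Set where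
  field
    k       : ℕ
    tree    : Graph k
    isTree  : IsTree tree
    bag     : Fin k → Subset n
    cover   : ∀ v → ∃[ t ] (v ∈ bag t)
    edgeCov : ∀ u v → E G u v → ∃[ t ] (u ∈ bag t × v ∈ bag t)
    coh     : ∀ v → ConnectedOn tree (λ t → v ∈ bag t)

WidthAtMost : ∀ {n} {G : Graph n} → TreeDecomposition G → ℕ → Set
WidthAtMost D w = ∀ t → ∣ TreeDecomposition.bag D t ∣ ≤ suc w

TwAtMost : ∀ {n} → Graph n → ℕ → Set
TwAtMost G w = Σ (TreeDecomposition G) (λ D → WidthAtMost D w)

-- A family of h distinct, nonempty, connected (vertex sets of) subgraphs of G.
IsFamily : ∀ {n h} → Graph n → (Fin h → Subset n) → Set
IsFamily G H =
  (∀ i j → H i ≡ H j → i ≡ j) ×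
  (∀ i → ∃[ v ] (v ∈ H i)) ×
  (∀ i → ConnectedOn G (λ v → v ∈ H i))

NonPiercing : ∀ {n h} → Graph n → (Fin h → Subset n) → Set
NonPiercing G H = ∀ i j → ConnectedOn G (λ v → (v ∈ H i) × (v ∉ H j))

DualSupport : ∀ {n h} → Graph n → (Fin h → Subset n) → Graph h → Set
DualSupport {n} G H Q = ∀ (v : Fin n) → ConnectedOn Q (λ i → v ∈ H i)

-- Let q = ⌊ m /2⌋.  The split graph whose core is a clique on the 2q pairs (t , s),
-- t < q, s < 2, completely joined to an independent set of pendant vertices has
-- treewidth at most 2q ≤ m (a star decomposition: the core plus one pendant per bag).
-- Index 2^q sets by binary words i: H i holds the core vertices (t , i_t) and the
-- pendants (a , b) with i ∈ {a , b}.  Two different words differ in some bit t, so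
-- H i ∖ H j contains the core vertex (t , i_t) and is connected.  The pendant (i , j)
-- lies only in H i and H j, which forces the edge i j into every dual support; so
-- every dual support is complete.  By the Helly property of subtrees of a tree, some
-- bag of any tree decomposition of a complete graph contains all its vertices, so its
-- width is at least 2^q − 1.  For m ≤ 3 families of two or three sets do the same job.
module Submission where

open import Defs
open import Data.Bool using (Bool; true; false; T; T?; _∨_; _∧_; not)
open import Data.Bool.Properties using (T-≡; T-∨; T-∧; ∨-comm; ∧-zeroʳ)
open import Data.Empty using (⊥-elim)
open import Data.Fin using (Fin; zero; suc; toℕ; inject₁; fromℕ; fromℕ<; #_; splitAt; join; combine; remQuot)
open import Data.Fin.Properties using (_≟_; any?; all?; ¬∀⟶∃¬; pigeonhole; toℕ-injective; toℕ<n; toℕ-inject₁; toℕ-fromℕ; toℕ-fromℕ<; splitAt-join; join-splitAt; splitAt-↑ˡ; remQuot-combine; combine-remQuot)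
open import Data.Fin.Subset using (Subset; _∈_; _∉_; _⊆_; ∣_∣; _─_; _-_; ⁅_⁆; ⊤; ⊥; inside; outside)
open import Data.Fin.Subset.Properties using (_∈?_; ∈⊤; ∣⊤∣≡n; ∣⊥∣≡0; ∣⁅x⁆∣≡1; ∣p∣≤n; p⊆q⇒∣p∣≤∣q∣; x∈p∧x≢y⇒x∈p-y; p─q⊆p; x∈⁅x⁆; x∈p⇒∣p-x∣<∣p∣)
open import Data.Nat using (ℕ; zero; suc; _+_; _*_; _^_; _∸_; _≤_; _<_; z≤n; s≤s; ⌊_/2⌋)
import Data.Nat.Properties as ℕ
open import Data.Product using (Σ; _×_; _,_; ∃; ∃-syntax; proj₁; proj₂; uncurry)
open import Data.Sum using (_⊎_; inj₁; inj₂; [_,_]; map₁)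
import Data.Sum.Properties as ⊎
open import Data.Unit using (tt)
open import Data.Vec using (_∷_; here; there; tabulate; lookup)
open import Data.Vec.Properties using (lookup∘tabulate; lookup⇒[]=; []=⇒lookup)
open import Function using (_∘_; Equivalence)
open import Relation.Binary.PropositionalEquality as ≡ using (_≡_; _≢_; refl; cong; subst; subst₂)
open import Relation.Nullary using (¬_; Dec; yes; no; does)
open import Relation.Nullary.Decidable using (_×-dec_; _→-dec_; _⊎-dec_; ¬?; map′; decidable-stable; dec-true; dec-false; toWitness; fromWitness; from-yes; ⌊_⌋)
open import Relation.Unary using (Decidable)

module _ {n} (G : Graph n) where

  E-sym : ∀ {u v} → E G u v → E G v u
  E-sym {u} {v} = subst T (sym G u v)

  E-irrefl : ∀ {u} → ¬ E G u u
  E-irrefl {u} = subst T (irrefl G u)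

  E⇒≢ : ∀ {u v} → E G u v → u ≢ v
  E⇒≢ e refl = E-irrefl e

module _ {n} {G : Graph n} where

  WalkIn-source : ∀ {S u v} → WalkIn G S u v → S u
  WalkIn-source (here s)     = s
  WalkIn-source (step s _ _) = s

  WalkIn-map : ∀ {S S′ : Fin n → Set} → (∀ {x} → S x → S′ x) → ∀ {u v} → WalkIn G S u v → WalkIn G S′ u v
  WalkIn-map f (here s)     = here (f s)
  WalkIn-map f (step s e w) = step (f s) e (WalkIn-map f w)

  ConnectedOn-subsingleton : ∀ {S} → (∀ u v → S u → S v → u ≡ v) → ConnectedOn G S
  ConnectedOn-subsingleton unique u v su sv = subst (WalkIn G _ u) (unique u v su sv) (here su)

LeafIn : ∀ {k} → Graph k → (Fin k → Set) → Fin k → Fin k → Set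
LeafIn G S ℓ p = S ℓ × S p × E G ℓ p × (∀ w → S w → E G ℓ w → w ≡ p)

module _ {k} (G : Graph k) (S : Fin k → Set) where

  -- A walk through the leaf ℓ enters and leaves it via p, so it can skip ℓ.
  WalkIn-avoid-leaf : ∀ {ℓ p} → (∀ w → S w → E G ℓ w → w ≡ p)
    → ∀ {u v} → u ≢ ℓ → v ≢ ℓ → WalkIn G S u v → WalkIn G (λ x → S x × x ≢ ℓ) u v
  WalkIn-avoid-leaf only u≢ℓ v≢ℓ (here su) = here (su , u≢ℓ)
  WalkIn-avoid-leaf {ℓ} only u≢ℓ v≢ℓ (step {w = w} su e rest) with w ≟ ℓ
  ... | no w≢ℓ = step (su , u≢ℓ) e (WalkIn-avoid-leaf only w≢ℓ v≢ℓ rest)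
  WalkIn-avoid-leaf only u≢ℓ v≢ℓ (step su e (here _)) | yes refl = ⊥-elim (v≢ℓ refl)
  WalkIn-avoid-leaf only u≢ℓ v≢ℓ (step {u = u} su e (step {w = w′} _ e′ rest)) | yes refl =
    subst (λ z → WalkIn G _ z _) (≡.trans (only w′ (WalkIn-source rest) e′) (≡.sym (only u su (E-sym G e))))
      (WalkIn-avoid-leaf only (λ w′≡ℓ → E-irrefl G (subst (E G _) w′≡ℓ e′)) v≢ℓ rest)

  record Path : Set where
    field
      len    : ℕ
      vertex : ℕ → Fin k
      inS    : ∀ i → i ≤ len → S (vertex i)
      inj    : ∀ i j → i ≤ len → j ≤ len → vertex i ≡ vertex j → i ≡ j
      edge   : ∀ i → i < len → E G (vertex i) (vertex (suc i))

  open Path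

  Path-len<size : (π : Path) → len π < k
  Path-len<size π = ℕ.≰⇒> λ k≤len →
    let (i , j , i<j , eq) = pigeonhole (s≤s k≤len) (λ i → vertex π (toℕ i))
    in ℕ.<⇒≢ i<j (inj π _ _ (ℕ.≤-pred (toℕ<n i)) (ℕ.≤-pred (toℕ<n j)) eq)

  Path-single : ∀ {u} → S u → Path
  Path-single {u} su = record
    { len = 0 ; vertex = λ _ → u ; inS = λ _ _ → su
    ; inj = λ { _ _ z≤n z≤n _ → refl } ; edge = λ _ () }

  private
    snoc : ℕ → (ℕ → Fin k) → Fin k → ℕ → Fin k
    snoc L P w i with i ℕ.≟ suc L
    ... | yes _ = w
    ... | no _  = P i

    snoc-old : ∀ L P w i → i ≤ L → snoc L P w i ≡ P i
    snoc-old L P w i i≤L with i ℕ.≟ suc L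
    ... | yes refl = ⊥-elim (ℕ.1+n≰n i≤L)
    ... | no _     = refl

    snoc-new : ∀ L P w → snoc L P w (suc L) ≡ w
    snoc-new L P w with suc L ℕ.≟ suc L
    ... | yes _ = refl
    ... | no ne = ⊥-elim (ne refl)

    ≤-suc-split : ∀ {i L} → i ≤ suc L → i ≤ L ⊎ i ≡ suc L
    ≤-suc-split i≤ with ℕ.m≤n⇒m<n∨m≡n i≤
    ... | inj₁ i< = inj₁ (ℕ.≤-pred i<)
    ... | inj₂ eq = inj₂ eq

  Path-extend : (π : Path) (w : Fin k) → S w → E G (vertex π (len π)) w
    → (∀ (r : Fin (suc (len π))) → vertex π (toℕ r) ≢ w) → Path
  Path-extend π w sw e fresh = record
    { len = suc L ; vertex = snoc L (vertex π) w ; inS = inS′ ; inj = inj′ ; edge = edge′ }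
    where
    L : ℕ
    L = len π
    old : ∀ i → i ≤ L → snoc L (vertex π) w i ≡ vertex π i
    old = snoc-old L (vertex π) w
    new : snoc L (vertex π) w (suc L) ≡ w
    new = snoc-new L (vertex π) w
    old≢w : ∀ i → i ≤ L → vertex π i ≢ w
    old≢w i i≤L eq = fresh (fromℕ< (s≤s i≤L)) (subst (λ z → vertex π z ≡ w) (≡.sym (toℕ-fromℕ< (s≤s i≤L))) eq)
    inS′ : ∀ i → i ≤ suc L → S (snoc L (vertex π) w i)
    inS′ i i≤ with ≤-suc-split i≤
    ... | inj₁ i≤L = subst S (≡.sym (old i i≤L)) (inS π i i≤L)
    ... | inj₂ refl = subst S (≡.sym new) sw
    inj′ : ∀ i j → i ≤ suc L → j ≤ suc L → snoc L (vertex π) w i ≡ snoc L (vertex π) w j → i ≡ j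
    inj′ i j i≤ j≤ eq with ≤-suc-split i≤ | ≤-suc-split j≤
    ... | inj₁ i≤L | inj₁ j≤L = inj π i j i≤L j≤L (≡.trans (≡.sym (old i i≤L)) (≡.trans eq (old j j≤L)))
    ... | inj₁ i≤L | inj₂ refl = ⊥-elim (old≢w i i≤L (≡.trans (≡.sym (old i i≤L)) (≡.trans eq new)))
    ... | inj₂ refl | inj₁ j≤L = ⊥-elim (old≢w j j≤L (≡.trans (≡.sym (old j j≤L)) (≡.trans (≡.sym eq) new)))
    ... | inj₂ refl | inj₂ refl = refl
    edge′ : ∀ i → i < suc L → E G (snoc L (vertex π) w i) (snoc L (vertex π) w (suc i))
    edge′ i i< with ≤-suc-split i<
    ... | inj₁ i<L = subst₂ (E G) (≡.sym (old i (ℕ.<⇒≤ i<L))) (≡.sym (old (suc i) i<L)) (edge π i i<L)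
    ... | inj₂ refl = subst₂ (E G) (≡.sym (old L ℕ.≤-refl)) (≡.sym new) e

  Path-close : (π : Path) (r l : ℕ) → len π ≡ r + suc (suc l) → E G (vertex π (len π)) (vertex π r) → Cycle G
  Path-close π r l len≡ closing = record { l = l ; c = c ; inj = c-inj ; edges = c-edges ; close = c-close }
    where
    c : Fin (3 + l) → Fin k
    c i = vertex π (r + toℕ i)
    in-range : (i : Fin (3 + l)) → r + toℕ i ≤ len π
    in-range i = subst (r + toℕ i ≤_) (≡.sym len≡) (ℕ.+-monoʳ-≤ r (ℕ.≤-pred (toℕ<n i)))
    c-inj : ∀ i j → c i ≡ c j → i ≡ j
    c-inj i j eq = toℕ-injective (ℕ.+-cancelˡ-≡ r _ _ (inj π _ _ (in-range i) (in-range j) eq))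
    c-edges : ∀ (i : Fin (2 + l)) → E G (c (inject₁ i)) (c (suc i))
    c-edges i = subst₂ (λ a b → E G (vertex π a) (vertex π b))
      (cong (r +_) (≡.sym (toℕ-inject₁ i))) (≡.sym (ℕ.+-suc r (toℕ i)))
      (edge π (r + toℕ i) (subst (r + toℕ i <_) (≡.sym len≡) (ℕ.+-monoʳ-< r (toℕ<n i))))
    c-close : E G (c (fromℕ (2 + l))) (c zero)
    c-close = subst₂ (λ a b → E G (vertex π a) (vertex π b))
      (≡.trans len≡ (cong (r +_) (≡.sym (toℕ-fromℕ (2 + l))))) (≡.sym (ℕ.+-identityʳ r)) closing

  -- w is neither the last vertex nor its predecessor, so the cycle has length at least 3.
  Path-close-back : (π : Path) {L′ : ℕ} → len π ≡ suc L′ → ∀ {w} → E G (vertex π (len π)) w → w ≢ vertex π L′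
    → (r : Fin (suc (len π))) → vertex π (toℕ r) ≡ w → Cycle G
  Path-close-back π {L′} refl {w} e w≢prev r r↦w = Path-close π (toℕ r) (L ∸ suc (suc (toℕ r))) len≡ (subst (E G _) (≡.sym r↦w) e)
    where
    L : ℕ
    L = suc L′
    r≢L : toℕ r ≢ L
    r≢L r≡L = E⇒≢ G e (subst (λ z → vertex π z ≡ w) r≡L r↦w)
    r≢L′ : toℕ r ≢ L′
    r≢L′ r≡L′ = w≢prev (≡.trans (≡.sym r↦w) (cong (vertex π) r≡L′))
    r<L : suc (toℕ r) ≤ L
    r<L = ℕ.≤∧≢⇒< (ℕ.≤-pred (toℕ<n r)) r≢L
    r+2≤L : suc (suc (toℕ r)) ≤ L
    r+2≤L = s≤s (ℕ.≤∧≢⇒< (ℕ.≤-pred r<L) r≢L′)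
    len≡ : L ≡ toℕ r + suc (suc (L ∸ suc (suc (toℕ r))))
    len≡ = ≡.trans (≡.sym (ℕ.m+[n∸m]≡n r+2≤L))
             (≡.sym (≡.trans (ℕ.+-suc (toℕ r) _) (cong suc (ℕ.+-suc (toℕ r) _))))

  NoLeafIn : Set
  NoLeafIn = ∀ u q → S u → S q → E G u q → ∃[ w ] (S w × E G u w × w ≢ q)

  -- Without leaves a path can always be continued; it cannot stay simple for k steps.
  NoLeafIn⇒Cycle : NoLeafIn → (f : ℕ) (π : Path) → 1 ≤ len π → k ≤ len π + f → Cycle G
  NoLeafIn⇒Cycle _ zero π _ k≤ = ⊥-elim (ℕ.<⇒≱ (Path-len<size π) (subst (k ≤_) (ℕ.+-identityʳ _) k≤))
  NoLeafIn⇒Cycle noLeaf (suc f) π (s≤s {n = L′} _) k≤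
    with noLeaf (vertex π (len π)) (vertex π L′) (inS π _ ℕ.≤-refl) (inS π L′ (ℕ.n≤1+n L′)) (E-sym G (edge π L′ ℕ.≤-refl))
  ... | w , sw , e , w≢prev with any? (λ (r : Fin (suc (len π))) → vertex π (toℕ r) ≟ w)
  ... | yes (r , r↦w) = Path-close-back π refl e w≢prev r r↦w
  ... | no fresh = NoLeafIn⇒Cycle noLeaf f (Path-extend π w sw e λ r eq → fresh (r , eq)) (s≤s z≤n)
                     (subst (k ≤_) (ℕ.+-suc (len π) f) k≤)

  LeafIn? : Decidable S → ∀ ℓ p → Dec (LeafIn G S ℓ p)
  LeafIn? S? ℓ p = S? ℓ ×-dec S? p ×-dec T? (adj G ℓ p) ×-dec all? (λ w → S? w →-dec T? (adj G ℓ w) →-dec w ≟ p)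

  leaf-exists : ¬ Cycle G → Decidable S → ConnectedOn G S
    → ∀ {t₁ t₂} → S t₁ → S t₂ → t₁ ≢ t₂ → ∃[ ℓ ] ∃[ p ] LeafIn G S ℓ p
  leaf-exists acyclic S? connected {t₁} {t₂} s₁ s₂ t₁≢t₂ with any? (λ ℓ → any? (LeafIn? S? ℓ))
  ... | yes (ℓ , p , leaf) = ℓ , p , leaf
  ... | no noLeaf = ⊥-elim (acyclic (NoLeafIn⇒Cycle continue k initial (s≤s z≤n) (ℕ.m≤n+m k 1)))
    where
    continue : NoLeafIn
    continue u q su sq e with any? (λ w → S? w ×-dec T? (adj G u w) ×-dec ¬? (w ≟ q))
    ... | yes branch = branch
    ... | no ¬branch = ⊥-elim (noLeaf (u , q , su , sq , e ,
            λ w sw e′ → decidable-stable (w ≟ q) (λ w≢q → ¬branch (w , sw , e′ , w≢q))))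
    first-step : WalkIn G S t₁ t₂ → ∃[ w ] (S w × E G t₁ w)
    first-step (here _) = ⊥-elim (t₁≢t₂ refl)
    first-step (step _ e rest) = _ , WalkIn-source rest , e
    initial : Path
    initial = let (w , sw , e) = first-step (connected t₁ t₂ s₁ s₂)
              in Path-extend (Path-single s₁) w sw e λ { zero eq → E⇒≢ G e eq }

x∈p─q⇒x∉q : ∀ {n} {x : Fin n} (p q : Subset n) → x ∈ p ─ q → x ∉ q
x∈p─q⇒x∉q (inside ∷ p) (outside ∷ q) here ()
x∈p─q⇒x∉q (_ ∷ p) (_ ∷ q) (there x∈) (there x∈q) = x∈p─q⇒x∉q p q x∈ x∈q

module Helly {k n} (tree : Graph k) (acyclic : ¬ Cycle tree) (bag : Fin k → Subset n) where

  PairwiseMeet : Subset k → Set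
  PairwiseMeet A = ∀ x y → ∃[ t ] (t ∈ A × x ∈ bag t × y ∈ bag t)

  Coherent : Subset k → Set
  Coherent A = ∀ x → ConnectedOn tree (λ t → t ∈ A × x ∈ bag t)

  module Prune {A : Subset k} {ℓ p} (leaf : LeafIn tree (_∈ A) ℓ p) where

    private
      only : ∀ w → w ∈ A → E tree ℓ w → w ≡ p
      only = proj₂ (proj₂ (proj₂ leaf))

    ∈-prune⁺ : ∀ {t} → t ∈ A → t ≢ ℓ → t ∈ A - ℓ
    ∈-prune⁺ = x∈p∧x≢y⇒x∈p-y

    ∈-prune⁻ : ∀ {t} → t ∈ A - ℓ → t ∈ A × t ≢ ℓ
    ∈-prune⁻ t∈ = p─q⊆p A ⁅ ℓ ⁆ t∈ , λ { refl → x∈p─q⇒x∉q A ⁅ ℓ ⁆ t∈ (x∈⁅x⁆ ℓ) }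

    p∈A-ℓ : p ∈ A - ℓ
    p∈A-ℓ = ∈-prune⁺ (proj₁ (proj₂ leaf)) λ { refl → E-irrefl tree (proj₁ (proj₂ (proj₂ leaf))) }

    connected : ConnectedOn tree (_∈ A) → ConnectedOn tree (_∈ A - ℓ)
    connected conA u v u∈ v∈ =
      WalkIn-map (λ (t∈A , t≢ℓ) → ∈-prune⁺ t∈A t≢ℓ)
        (WalkIn-avoid-leaf tree (_∈ A) only (proj₂ (∈-prune⁻ u∈)) (proj₂ (∈-prune⁻ v∈))
          (conA u v (proj₁ (∈-prune⁻ u∈)) (proj₁ (∈-prune⁻ v∈))))

    coherent : Coherent A → Coherent (A - ℓ)
    coherent coh x u v (u∈ , xu) (v∈ , xv) =
      WalkIn-map (λ ((t∈A , xt) , t≢ℓ) → ∈-prune⁺ t∈A t≢ℓ , xt)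
        (WalkIn-avoid-leaf tree (λ t → t ∈ A × x ∈ bag t) (λ w (w∈ , _) → only w w∈)
          (proj₂ (∈-prune⁻ u∈)) (proj₂ (∈-prune⁻ v∈))
          (coh x u v (proj₁ (∈-prune⁻ u∈) , xu) (proj₁ (∈-prune⁻ v∈) , xv)))

    pairwise : bag ℓ ⊆ bag p → PairwiseMeet A → PairwiseMeet (A - ℓ)
    pairwise ℓ⊆p meet x y with meet x y
    ... | t , t∈A , xt , yt with t ≟ ℓ
    ... | yes refl = p , p∈A-ℓ , ℓ⊆p xt , ℓ⊆p yt
    ... | no t≢ℓ   = t , ∈-prune⁺ t∈A t≢ℓ , xt , yt

    -- x lives only in the leaf bag, and every y shares a bag with x.
    private-vertex⇒full : Coherent A → PairwiseMeet A → ∀ {x} → x ∈ bag ℓ → x ∉ bag p → ∀ y → y ∈ bag ℓ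
    private-vertex⇒full coh meet {x} xℓ x∉p y with meet x y
    ... | t , t∈A , xt , yt = subst (λ z → y ∈ bag z) (≡.sym (stuck (coh x ℓ t (proj₁ leaf , xℓ) (t∈A , xt)))) yt
      where
      stuck : ∀ {t} → WalkIn tree (λ t → t ∈ A × x ∈ bag t) ℓ t → ℓ ≡ t
      stuck (here _) = refl
      stuck (step {w = w} _ e rest) with WalkIn-source rest
      ... | w∈A , xw = ⊥-elim (x∉p (subst (λ z → x ∈ bag z) (only w w∈A e) xw))

  -- Induct on ∣ A ∣ through a leaf ℓ of A hanging from p: if bag ℓ ⊆ bag p, prune ℓ;
  -- otherwise bag ℓ already contains every vertex.
  helly : (fuel : ℕ) (A : Subset k) → ∣ A ∣ < fuel → ∃[ t ] t ∈ A → ConnectedOn tree (_∈ A)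
        → PairwiseMeet A → Coherent A → ∃[ t ] (t ∈ A × ∀ x → x ∈ bag t)
  helly (suc f) A |A|<f (t₀ , t₀∈A) conA meet coh with any? (λ t → (t ∈? A) ×-dec ¬? (t ≟ t₀))
  ... | no single = t₀ , t₀∈A , λ x → at-t₀ (meet x x)
    where
    at-t₀ : ∀ {x} → ∃[ t ] (t ∈ A × x ∈ bag t × x ∈ bag t) → x ∈ bag t₀
    at-t₀ (t , t∈A , xt , _) with t ≟ t₀
    ... | yes refl = xt
    ... | no t≢t₀ = ⊥-elim (single (t , t∈A , t≢t₀))
  ... | yes (t₁ , t₁∈A , t₁≢t₀) with leaf-exists tree (_∈ A) acyclic (_∈? A) conA t₁∈A t₀∈A t₁≢t₀
  ... | ℓ , p , leaf with any? (λ x → (x ∈? bag ℓ) ×-dec ¬? (x ∈? bag p))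
  ... | yes (x , xℓ , x∉p) = ℓ , proj₁ leaf , Prune.private-vertex⇒full leaf coh meet xℓ x∉p
  ... | no ¬private
    with helly f (A - ℓ) (ℕ.<-≤-trans (x∈p⇒∣p-x∣<∣p∣ (proj₁ leaf)) (ℕ.≤-pred |A|<f)) (p , p∈A-ℓ)
           (connected conA) (pairwise ℓ⊆p meet) (coherent coh)
    where
    open Prune leaf
    ℓ⊆p : bag ℓ ⊆ bag p
    ℓ⊆p {x} xℓ = decidable-stable (x ∈? bag p) (λ x∉p → ¬private (x , xℓ , x∉p))
  ... | t , t∈A-ℓ , full = t , proj₁ (Prune.∈-prune⁻ leaf t∈A-ℓ) , full

module _ {h} (Q : Graph h) (complete : ∀ i j → i ≢ j → E Q i j) where

  complete⇒common-bag : (D : TreeDecomposition Q) → ∃[ t ] ∀ i → i ∈ TreeDecomposition.bag D t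
  complete⇒common-bag D with Helly.helly tree acyclic bag (suc ∣ ⊤ {k} ∣) ⊤ ℕ.≤-refl
                               (fromℕ< k≥1 , ∈⊤) conA meet coh′
    where
    open TreeDecomposition D
    k≥1 : 1 ≤ k
    k≥1 = proj₁ isTree
    acyclic : ¬ Cycle tree
    acyclic = proj₂ (proj₂ isTree)
    conA : ConnectedOn tree (_∈ ⊤)
    conA u v _ _ = WalkIn-map (λ _ → ∈⊤) (proj₁ (proj₂ isTree) u v tt tt)
    meet : Helly.PairwiseMeet tree acyclic bag ⊤
    meet i j with i ≟ j
    ... | yes refl = let (t , i∈) = cover i in t , ∈⊤ , i∈ , i∈
    ... | no i≢j   = let (t , i∈ , j∈) = edgeCov i j (complete i j i≢j) in t , ∈⊤ , i∈ , j∈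
    coh′ : Helly.Coherent tree acyclic bag ⊤
    coh′ i u v (_ , iu) (_ , iv) = WalkIn-map (∈⊤ ,_) (coh i u v iu iv)
  ... | t , _ , full = t , full

  complete⇒size≤1+width : ∀ w → TwAtMost Q w → h ≤ suc w
  complete⇒size≤1+width w (D , width) with complete⇒common-bag D
  ... | t , full = ℕ.≤-trans (ℕ.≤-reflexive (≡.sym (∣⊤∣≡n h)))
                     (ℕ.≤-trans (p⊆q⇒∣p∣≤∣q∣ {p = ⊤} λ {i} _ → full i) (width t))

∈-tabulate⁺ : ∀ {n} {f : Fin n → Bool} {v} → T (f v) → v ∈ tabulate f
∈-tabulate⁺ {f = f} {v} fv = lookup⇒[]= v (tabulate f) (≡.trans (lookup∘tabulate f v) (Equivalence.to T-≡ fv))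

∈-tabulate⁻ : ∀ {n} {f : Fin n → Bool} {v} → v ∈ tabulate f → T (f v)
∈-tabulate⁻ {f = f} {v} v∈ = Equivalence.from T-≡ (≡.trans (≡.sym (lookup∘tabulate f v)) ([]=⇒lookup v∈))

does-≟-sym : ∀ {n} (u v : Fin n) → does (u ≟ v) ≡ does (v ≟ u)
does-≟-sym u v with u ≟ v
... | yes u≡v = ≡.sym (dec-true (v ≟ u) (≡.sym u≡v))
... | no u≢v  = ≡.sym (dec-false (v ≟ u) (u≢v ∘ ≡.sym))

isCore : ∀ {c P} → Fin c ⊎ Fin P → Bool
isCore (inj₁ _) = true
isCore (inj₂ _) = false

splitGraph : ∀ c P → Graph (c + P)
splitGraph c P = record { adj = adjacent ; sym = adjacent-sym ; irrefl = adjacent-irrefl }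
  where
  adjacent : Fin (c + P) → Fin (c + P) → Bool
  adjacent u v = (isCore (splitAt c u) ∨ isCore (splitAt c v)) ∧ not (does (u ≟ v))
  adjacent-sym : ∀ u v → adjacent u v ≡ adjacent v u
  adjacent-sym u v = ≡.cong₂ _∧_ (∨-comm (isCore (splitAt c u)) _) (cong not (does-≟-sym u v))
  adjacent-irrefl : ∀ u → adjacent u u ≡ false
  adjacent-irrefl u = ≡.trans (cong (λ b → (isCore (splitAt c u) ∨ isCore (splitAt c u)) ∧ not b) (dec-true (u ≟ u) refl)) (∧-zeroʳ _)

toSubset : ∀ {c P} → (Fin c ⊎ Fin P → Bool) → Subset (c + P)
toSubset {c} f = tabulate (f ∘ splitAt c)

module SplitGraph (c P : ℕ) where

  G : Graph (c + P)
  G = splitGraph c P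

  IsCore : Fin (c + P) → Set
  IsCore v = T (isCore (splitAt c v))

  core-adj : ∀ {u v} → IsCore u → u ≢ v → E G u v
  core-adj {u} {v} cu u≢v = Equivalence.from T-∧
    ( Equivalence.from T-∨ (inj₁ cu)
    , subst (T ∘ not) (≡.sym (dec-false (u ≟ v) u≢v)) tt )

  edge-has-core : ∀ u v → E G u v → IsCore u ⊎ IsCore v
  edge-has-core _ _ e = Equivalence.to T-∨ (proj₁ (Equivalence.to T-∧ e))

  ConnectedOn-core : ∀ {S a} → IsCore a → S a → ConnectedOn G S
  ConnectedOn-core {S} {a} ca sa u v su sv with u ≟ v | T? (isCore (splitAt c u)) | T? (isCore (splitAt c v))
  ... | yes refl | _ | _ = here su
  ... | no u≢v | yes cu | _ = step su (core-adj cu u≢v) (here sv)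
  ... | no u≢v | no _ | yes cv = step su (E-sym G (core-adj cv (u≢v ∘ ≡.sym))) (here sv)
  ... | no _ | no ¬cu | no ¬cv =
    step su (E-sym G (core-adj ca λ { refl → ¬cu ca })) (step sa (core-adj ca λ { refl → ¬cv ca }) (here sv))

  splitAt-injective : ∀ {u v} → splitAt c u ≡ splitAt c v → u ≡ v
  splitAt-injective {u} {v} eq =
    ≡.trans (≡.sym (join-splitAt c P u)) (≡.trans (cong (join c P) eq) (join-splitAt c P v))

  core-join : ∀ a → IsCore (join c P (inj₁ a))
  core-join a = subst (T ∘ isCore) (≡.sym (splitAt-↑ˡ c a P)) tt

  ∈-toSubset⁺ : ∀ f {x} → T (f x) → join c P x ∈ toSubset f
  ∈-toSubset⁺ f fx = ∈-tabulate⁺ (subst (T ∘ f) (≡.sym (splitAt-join c P _)) fx)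

  ∈-toSubset⁻ : ∀ f {x} → join c P x ∈ toSubset f → T (f x)
  ∈-toSubset⁻ f x∈ = subst (T ∘ f) (splitAt-join c P _) (∈-tabulate⁻ {f = f ∘ splitAt c} x∈)

  toSubset-pointwise : ∀ {f g} → toSubset f ≡ toSubset g → ∀ x → f x ≡ g x
  toSubset-pointwise {f} {g} eq x = begin
    f x                                     ≡⟨ cong f (≡.sym (splitAt-join c P x)) ⟩
    f (splitAt c (join c P x))              ≡⟨ ≡.sym (lookup∘tabulate (f ∘ splitAt c) (join c P x)) ⟩
    lookup (toSubset f) (join c P x)        ≡⟨ cong (λ s → lookup s (join c P x)) eq ⟩
    lookup (toSubset g) (join c P x)        ≡⟨ lookup∘tabulate (g ∘ splitAt c) (join c P x) ⟩
    g (splitAt c (join c P x))              ≡⟨ cong g (splitAt-join c P x) ⟩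
    g x                                     ∎
    where open ≡.≡-Reasoning

  ∣toSubset∣ : ∀ f → ∣ toSubset f ∣ ≡ ∣ tabulate (f ∘ inj₁) ∣ + ∣ tabulate (f ∘ inj₂) ∣
  ∣toSubset∣ f = count c f
    where
    count : ∀ c (f : Fin c ⊎ Fin P → Bool) → ∣ tabulate (f ∘ splitAt c) ∣ ≡ ∣ tabulate (f ∘ inj₁) ∣ + ∣ tabulate (f ∘ inj₂) ∣
    count zero    f = refl
    count (suc c) f with f (inj₁ zero)
    ... | true  = cong suc (count c (f ∘ map₁ suc))
    ... | false = count c (f ∘ map₁ suc)

module Star (P : ℕ) where

  open SplitGraph 1 P using (IsCore; edge-has-core) renaming (G to star)

  center : ∀ {u} → IsCore u → u ≡ zero
  center {zero} _ = refl

  one-center : (C : Cycle star) → ∀ {i j} → IsCore (Cycle.c C i) → IsCore (Cycle.c C j) → i ≡ j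
  one-center C ci cj = Cycle.inj C _ _ (≡.trans (center ci) (≡.sym (center cj)))

  -- The cycle neighbours of c 2 are c 1 and another vertex, so neither is the centre.
  ¬center-at-1 : (C : Cycle star) → ¬ IsCore (Cycle.c C (# 1))
  ¬center-at-1 C@record { l = zero ; c = c ; close = close } c₁ with edge-has-core (c (# 2)) (c (# 0)) close
  ... | inj₁ c₂ with one-center C {# 2} {# 1} c₂ c₁
  ...   | ()
  ¬center-at-1 C@record { l = zero } c₁ | inj₂ c₀ with one-center C {# 0} {# 1} c₀ c₁
  ...   | ()
  ¬center-at-1 C@record { l = suc _ ; c = c ; edges = edges } c₁ with edge-has-core (c (# 2)) (c (# 3)) (edges (# 2))
  ... | inj₁ c₂ with one-center C {# 2} {# 1} c₂ c₁
  ...   | ()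
  ¬center-at-1 C@record { l = suc _ } c₁ | inj₂ c₃ with one-center C {# 3} {# 1} c₃ c₁
  ...   | ()

  star-acyclic : ¬ Cycle star
  star-acyclic C@record { c = c ; edges = edges }
    with edge-has-core (c (# 0)) (c (# 1)) (edges (# 0)) | edge-has-core (c (# 1)) (c (# 2)) (edges (# 1))
  ... | inj₂ c₁ | _       = ¬center-at-1 C c₁
  ... | inj₁ _  | inj₁ c₁ = ¬center-at-1 C c₁
  ... | inj₁ c₀ | inj₂ c₂ with one-center C {# 0} {# 2} c₀ c₂
  ...   | ()

module SplitDecomposition (c P : ℕ) where

  open SplitGraph c P
  open Star P using (star-acyclic)
  open SplitGraph 1 P using () renaming (G to star; ConnectedOn-core to star-ConnectedOn-center)

  -- The centre zero of the star carries the core; its leaf suc q also carries pendant q.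
  inBag : Fin (1 + P) → Fin c ⊎ Fin P → Bool
  inBag _       (inj₁ _) = true
  inBag zero    (inj₂ _) = false
  inBag (suc q) (inj₂ p) = ⌊ q ≟ p ⌋

  bag : Fin (1 + P) → Subset (c + P)
  bag t = toSubset (inBag t)

  pendants-in-bag≤1 : ∀ t → ∣ tabulate (inBag t ∘ inj₂) ∣ ≤ 1
  pendants-in-bag≤1 zero = ℕ.≤-trans (p⊆q⇒∣p∣≤∣q∣ {p = tabulate (inBag zero ∘ inj₂)} {q = ⊥} λ p∈ → ⊥-elim (∈-tabulate⁻ p∈)) (ℕ.≤-trans (ℕ.≤-reflexive (∣⊥∣≡0 P)) z≤n)
  pendants-in-bag≤1 (suc q) = ℕ.≤-trans (p⊆q⇒∣p∣≤∣q∣ {p = tabulate (inBag (suc q) ∘ inj₂)} only-q) (ℕ.≤-reflexive (∣⁅x⁆∣≡1 q))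
    where
    only-q : tabulate (inBag (suc q) ∘ inj₂) ⊆ ⁅ q ⁆
    only-q {p} p∈ = subst (_∈ ⁅ q ⁆) (toWitness {a? = q ≟ p} (∈-tabulate⁻ p∈)) (x∈⁅x⁆ q)

  bag-size : ∀ t → ∣ bag t ∣ ≤ suc c
  bag-size t = begin
    ∣ bag t ∣                                                     ≡⟨ ∣toSubset∣ (inBag t) ⟩
    ∣ tabulate (inBag t ∘ inj₁) ∣ + ∣ tabulate (inBag t ∘ inj₂) ∣ ≤⟨ ℕ.+-mono-≤ (∣p∣≤n (tabulate (inBag t ∘ inj₁))) (pendants-in-bag≤1 t) ⟩
    c + 1                                                         ≡⟨ ℕ.+-comm c 1 ⟩
    suc c                                                         ∎
    where open ℕ.≤-Reasoning

  core∈bag : ∀ {v} → IsCore v → ∀ t → v ∈ bag t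
  core∈bag {v} cv t = ∈-tabulate⁺ (core-inBag (splitAt c v) cv)
    where
    core-inBag : ∀ x → T (isCore x) → T (inBag t x)
    core-inBag (inj₁ _) _ = tt

  home : ∀ v → ∃[ t ] (v ∈ bag t)
  home v = let (t , in-t) = home′ (splitAt c v) in t , ∈-tabulate⁺ in-t
    where
    home′ : ∀ x → ∃[ t ] T (inBag t x)
    home′ (inj₁ _) = zero , tt
    home′ (inj₂ p) = suc p , fromWitness {a? = p ≟ p} refl

  coherent : ∀ x → ConnectedOn star (λ t → T (inBag t x))
  coherent (inj₁ _) = star-ConnectedOn-center {a = zero} tt tt
  coherent (inj₂ p) = ConnectedOn-subsingleton λ u v pu pv → ≡.trans (at-leaf u pu) (≡.sym (at-leaf v pv))
    where
    at-leaf : ∀ t → T (inBag t (inj₂ p)) → t ≡ suc p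
    at-leaf (suc q) q≡p = cong suc (toWitness {a? = q ≟ p} q≡p)

  decomposition : TreeDecomposition G
  decomposition = record
    { k = 1 + P ; tree = star
    ; isTree = s≤s z≤n , star-ConnectedOn-center {a = zero} tt tt , star-acyclic
    ; bag = bag ; cover = home ; edgeCov = edge-covered
    ; coh = λ v t t′ vt vt′ → WalkIn-map ∈-tabulate⁺ (coherent (splitAt c v) t t′ (∈-tabulate⁻ vt) (∈-tabulate⁻ vt′)) }
    where
    edge-covered : ∀ u v → E G u v → ∃[ t ] (u ∈ bag t × v ∈ bag t)
    edge-covered u v e with edge-has-core u v e
    ... | inj₁ cu = let (t , v∈) = home v in t , core∈bag cu t , v∈
    ... | inj₂ cv = let (t , u∈) = home u in t , u∈ , core∈bag cv t

  splitGraph-tw : ∀ {m} → c ≤ m → TwAtMost G m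
  splitGraph-tw c≤m = decomposition , λ t → ℕ.≤-trans (bag-size t) (s≤s c≤m)

module _ {c P h : ℕ} (member : Fin h → Fin c ⊎ Fin P → Bool) where

  InDifference : Fin h → Fin h → Fin c ⊎ Fin P → Set
  InDifference i j x = T (member i x) × ¬ T (member j x)

  record IsSplitFamily : Set where
    field
      core-member    : ∀ i → ∃[ a ] T (member i (inj₁ a))
      distinct       : ∀ i j → i ≢ j → ∃[ x ] (member i x ≢ member j x)
      difference     : ∀ i j → (∃[ a ] InDifference i j (inj₁ a))
                                ⊎ (∀ x y → InDifference i j x → InDifference i j y → x ≡ y)
      private-vertex : ∀ i j → i ≢ j
                       → ∃[ x ] (T (member i x) × T (member j x) × (∀ l → T (member l x) → l ≡ i ⊎ l ≡ j))

module _ {c P} {Q : Fin c ⊎ Fin P → Set} (Q? : Decidable Q) where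

  any⊎? : Dec (∃ Q)
  any⊎? = map′ [ (λ (a , q) → inj₁ a , q) , (λ (p , q) → inj₂ p , q) ]
               (λ { (inj₁ a , q) → inj₁ (a , q) ; (inj₂ p , q) → inj₂ (p , q) })
               (any? (Q? ∘ inj₁) ⊎-dec any? (Q? ∘ inj₂))

  all⊎? : Dec (∀ x → Q x)
  all⊎? = map′ (λ (f , g) → [ f , g ]) (λ f → f ∘ inj₁ , f ∘ inj₂) (all? (Q? ∘ inj₁) ×-dec all? (Q? ∘ inj₂))

isSplitFamily? : ∀ {c P h} (member : Fin h → Fin c ⊎ Fin P → Bool) → Dec (IsSplitFamily member)
isSplitFamily? member =
  map′ (λ (a , b , c , d) → record { core-member = a ; distinct = b ; difference = c ; private-vertex = d })
       (λ F → let open IsSplitFamily F in core-member , distinct , difference , private-vertex)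
       (all? (λ i → any? λ a → T? (member i (inj₁ a)))
        ×-dec all? (λ i → all? λ j → ¬? (i ≟ j) →-dec any⊎? λ x → ¬? (member i x Data.Bool.≟ member j x))
        ×-dec all? (λ i → all? λ j → any? (λ a → diff? i j (inj₁ a))
                                    ⊎-dec all⊎? λ x → all⊎? λ y → diff? i j x →-dec diff? i j y →-dec ⊎.≡-dec _≟_ _≟_ x y)
        ×-dec all? (λ i → all? λ j → ¬? (i ≟ j) →-dec any⊎? λ x →
                 T? (member i x) ×-dec T? (member j x) ×-dec all? λ l → T? (member l x) →-dec (l ≟ i ⊎-dec l ≟ j)))
  where
  diff? : ∀ i j → Decidable (InDifference member i j)
  diff? i j x = T? (member i x) ×-dec ¬? (T? (member j x))

module SplitFamily {c P h} {member : Fin h → Fin c ⊎ Fin P → Bool} (F : IsSplitFamily member) where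

  open SplitGraph c P
  open IsSplitFamily F

  sets : Fin h → Subset (c + P)
  sets i = toSubset (member i)

  sets-injective : ∀ i j → sets i ≡ sets j → i ≡ j
  sets-injective i j eq with i ≟ j
  ... | yes i≡j = i≡j
  ... | no i≢j  = let (x , differ) = distinct i j i≢j in ⊥-elim (differ (toSubset-pointwise {member i} {member j} eq x))

  sets-family : IsFamily G sets
  sets-family = sets-injective
              , (λ i → let (a , a∈) = core-member i in join c P (inj₁ a) , ∈-toSubset⁺ (member i) a∈)
              , (λ i → let (a , a∈) = core-member i in ConnectedOn-core (core-join a) (∈-toSubset⁺ (member i) a∈))

  sets-nonPiercing : NonPiercing G sets
  sets-nonPiercing i j with difference i j
  ... | inj₁ (a , a∈i , a∉j) = ConnectedOn-core (core-join a) (∈-toSubset⁺ (member i) a∈i , a∉j ∘ ∈-toSubset⁻ (member j))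
  ... | inj₂ unique = ConnectedOn-subsingleton λ u v (u∈i , u∉j) (v∈i , v∉j) → splitAt-injective
          (unique _ _ (∈-tabulate⁻ {f = member i ∘ splitAt c} u∈i , u∉j ∘ ∈-tabulate⁺)
                   (∈-tabulate⁻ {f = member i ∘ splitAt c} v∈i , v∉j ∘ ∈-tabulate⁺))

  -- The private vertex of i and j lies in no other set, so a walk from i to j
  -- within the sets containing it is the single edge i j.
  dualSupport-complete : ∀ (Q : Graph h) → DualSupport G sets Q → ∀ i j → i ≢ j → E Q i j
  dualSupport-complete Q support i j i≢j with private-vertex i j i≢j
  ... | x , x∈i , x∈j , only = direct (support (join c P x) i j (∈-toSubset⁺ (member i) x∈i) (∈-toSubset⁺ (member j) x∈j))
    where
    direct : WalkIn Q (λ l → join c P x ∈ sets l) i j → E Q i j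
    direct (here _) = ⊥-elim (i≢j refl)
    direct (step {w = w} _ e rest) with only w (∈-toSubset⁻ (member w) (WalkIn-source rest))
    ... | inj₁ refl = ⊥-elim (E-irrefl Q e)
    ... | inj₂ refl = e

  dualSupport-tw : ∀ (Q : Graph h) → DualSupport G sets Q → ∀ w → TwAtMost Q w → h ≤ suc w
  dualSupport-tw Q support = complete⇒size≤1+width Q (dualSupport-complete Q support)

bits : ∀ q → Fin (2 ^ q) → Fin q → Fin 2
bits (suc q) i zero    = proj₁ (remQuot {2} (2 ^ q) i)
bits (suc q) i (suc t) = bits q (proj₂ (remQuot {2} (2 ^ q) i)) t

bits-injective : ∀ q {i j} → (∀ t → bits q i t ≡ bits q j t) → i ≡ j
bits-injective zero    {zero} {zero} _ = refl
bits-injective (suc q) {i} {j} same = begin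
  i                                       ≡⟨ ≡.sym (combine-remQuot {2} (2 ^ q) i) ⟩
  uncurry combine (remQuot {2} (2 ^ q) i) ≡⟨ cong (uncurry combine) (≡.cong₂ _,_ (same zero) (bits-injective q (same ∘ suc))) ⟩
  uncurry combine (remQuot {2} (2 ^ q) j) ≡⟨ combine-remQuot {2} (2 ^ q) j ⟩
  j                                       ∎
  where open ≡.≡-Reasoning

bits-differ : ∀ q {i j} → i ≢ j → ∃[ t ] (bits q i t ≢ bits q j t)
bits-differ q {i} {j} i≢j = ¬∀⟶∃¬ q _ (λ t → bits q i t ≟ bits q j t) (i≢j ∘ bits-injective q)

module Binary (q′ : ℕ) where

  q : ℕ
  q = suc q′

  -- Sets are indexed by binary words i of length q.  The core vertex (t , s) says
  -- "bit t is s" and lies in H i iff bit t of i is s; the pendant (a , b) lies in H a and H b.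
  member : Fin (2 ^ q) → Fin (q * 2) ⊎ Fin (2 ^ q * 2 ^ q) → Bool
  member i (inj₁ x) = let (t , s) = remQuot {q} 2 x in ⌊ bits q i t ≟ s ⌋
  member i (inj₂ y) = let (a , b) = remQuot {2 ^ q} (2 ^ q) y in ⌊ a ≟ i ⌋ ∨ ⌊ b ≟ i ⌋

  member-core : ∀ i t s → member i (inj₁ (combine t s)) ≡ ⌊ bits q i t ≟ s ⌋
  member-core i t s = cong (λ (t , s) → ⌊ bits q i t ≟ s ⌋) (remQuot-combine t s)

  member-pendant : ∀ i a b → member i (inj₂ (combine a b)) ≡ ⌊ a ≟ i ⌋ ∨ ⌊ b ≟ i ⌋
  member-pendant i a b = cong (λ (a , b) → ⌊ a ≟ i ⌋ ∨ ⌊ b ≟ i ⌋) (remQuot-combine a b)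

  own-bit : ∀ i t → T (member i (inj₁ (combine t (bits q i t))))
  own-bit i t = subst T (≡.sym (member-core i t _)) (fromWitness {a? = bits q i t ≟ bits q i t} refl)

  other-bit : ∀ {i j t} → bits q i t ≢ bits q j t → ¬ T (member j (inj₁ (combine t (bits q i t))))
  other-bit {i} {j} {t} differ j∋ =
    differ (≡.sym (toWitness {a? = bits q j t ≟ bits q i t} (subst T (member-core j t _) j∋)))

  isSplitFamily : IsSplitFamily member
  isSplitFamily = record
    { core-member    = λ i → combine {q} zero (bits q i zero) , own-bit i zero
    ; distinct       = distinct
    ; difference     = difference
    ; private-vertex = private-vertex }
    where
    distinct : ∀ i j → i ≢ j → ∃[ x ] (member i x ≢ member j x)
    distinct i j i≢j = let (t , differ) = bits-differ q i≢j in
      inj₁ (combine {q} t (bits q i t)) , λ same → other-bit {i} {j} {t} differ (subst T same (own-bit i t))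
    difference : ∀ i j → (∃[ a ] InDifference member i j (inj₁ a))
                         ⊎ (∀ x y → InDifference member i j x → InDifference member i j y → x ≡ y)
    difference i j with i ≟ j
    ... | yes refl = inj₂ λ _ _ (x∈ , x∉) _ → ⊥-elim (x∉ x∈)
    ... | no i≢j   = let (t , differ) = bits-differ q i≢j in inj₁ (combine {q} t (bits q i t) , own-bit i t , other-bit {i} {j} {t} differ)
    private-vertex : ∀ i j → i ≢ j
      → ∃[ x ] (T (member i x) × T (member j x) × (∀ l → T (member l x) → l ≡ i ⊎ l ≡ j))
    private-vertex i j _ = inj₂ (combine i j)
      , subst T (≡.sym (member-pendant i i j)) (Equivalence.from T-∨ (inj₁ (fromWitness {a? = i ≟ i} refl)))
      , subst T (≡.sym (member-pendant j i j)) (Equivalence.from T-∨ (inj₂ (fromWitness {a? = j ≟ j} refl)))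
      , λ l l∋ → Data.Sum.map (≡.sym ∘ toWitness {a? = i ≟ l}) (≡.sym ∘ toWitness {a? = j ≟ l})
                   (Equivalence.to T-∨ (subst T (member-pendant l i j) l∋))

edgeFamily : Fin 2 → Fin 1 ⊎ Fin 1 → Bool
edgeFamily zero       = isCore
edgeFamily (suc zero) = λ _ → true

triangleFamily : Fin 3 → Fin 2 ⊎ Fin 1 → Bool
triangleFamily zero    x        = isCore x
triangleFamily (suc k) (inj₁ a) = ⌊ a ≟ k ⌋
triangleFamily (suc k) (inj₂ _) = true

edgeFamily-isSplit : IsSplitFamily edgeFamily
edgeFamily-isSplit = from-yes (isSplitFamily? edgeFamily)

triangleFamily-isSplit : IsSplitFamily triangleFamily
triangleFamily-isSplit = from-yes (isSplitFamily? triangleFamily)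

⌊n/2⌋*2≤n : ∀ n → ⌊ n /2⌋ * 2 ≤ n
⌊n/2⌋*2≤n zero          = z≤n
⌊n/2⌋*2≤n (suc zero)    = z≤n
⌊n/2⌋*2≤n (suc (suc n)) = s≤s (s≤s (⌊n/2⌋*2≤n n))

4^r≡2^r*2^r : ∀ r → 4 ^ r ≡ 2 ^ r * 2 ^ r
4^r≡2^r*2^r r = begin
  4 ^ r               ≡⟨ ℕ.^-*-assoc 2 2 r ⟩
  2 ^ (r + (r + 0))   ≡⟨ ℕ.^-distribˡ-+-* 2 r (r + 0) ⟩
  2 ^ r * 2 ^ (r + 0) ≡⟨ cong (λ e → 2 ^ r * 2 ^ e) (ℕ.+-identityʳ r) ⟩
  2 ^ r * 2 ^ r       ∎
  where open ≡.≡-Reasoning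

4^-bound : ∀ {m w} r → 4 ≤ m → 2 ^ suc r ≤ suc w → 4 ^ suc r ≤ m * (w * w)
4^-bound {m} {w} r 4≤m 2^r+1≤w+1 = begin
  4 * 4 ^ r           ≡⟨ cong (4 *_) (4^r≡2^r*2^r r) ⟩
  4 * (2 ^ r * 2 ^ r) ≤⟨ ℕ.*-mono-≤ 4≤m (ℕ.*-mono-≤ 2^r≤w 2^r≤w) ⟩
  m * (w * w)         ∎
  where
  open ℕ.≤-Reasoning
  2^r≤w : 2 ^ r ≤ w
  2^r≤w = ℕ.≤-pred (begin
    suc (2 ^ r) ≡⟨ ℕ.+-comm 1 (2 ^ r) ⟩
    2 ^ r + 1   ≤⟨ ℕ.+-monoʳ-≤ (2 ^ r) (ℕ.≤-trans (ℕ.m^n>0 2 r) (ℕ.m≤m+n _ 0)) ⟩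
    2 ^ suc r   ≤⟨ 2^r+1≤w+1 ⟩
    suc w       ∎)

Construction : ℕ → Set
Construction m =
  Σ ℕ λ n → Σ (Graph n) λ G → TwAtMost G m ×
    (Σ ℕ λ h → Σ (Fin h → Subset n) λ H →
      IsFamily G H × NonPiercing G H ×
      (∀ (Q : Graph h) → DualSupport G H Q →
        ∀ (w : ℕ) → TwAtMost Q w → 4 ^ ⌊ m /2⌋ ≤ m * (w * w)))

split-construction : ∀ {m c P h} {member : Fin h → Fin c ⊎ Fin P → Bool} → IsSplitFamily member → c ≤ m
  → (∀ w → h ≤ suc w → 4 ^ ⌊ m /2⌋ ≤ m * (w * w)) → Construction m
split-construction {c = c} {P} {h} F c≤m bound =
  c + P , splitGraph c P , splitGraph-tw c≤m , h , sets , sets-family , sets-nonPiercing ,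
  λ Q support w tw → bound w (dualSupport-tw Q support w tw)
  where
  open SplitFamily F
  open SplitDecomposition c P

theorem5 : ∀ (m : ℕ) → 1 ≤ m →
    Σ ℕ λ n → Σ (Graph n) λ G → TwAtMost G m ×
      (Σ ℕ λ h → Σ (Fin h → Subset n) λ H →
        IsFamily G H × NonPiercing G H ×
        (∀ (Q : Graph h) → DualSupport G H Q →
          ∀ (w : ℕ) → TwAtMost Q w → 4 ^ ⌊ m /2⌋ ≤ m * (w * w)))
theorem5 1 1≤m = split-construction edgeFamily-isSplit ℕ.≤-refl
  λ { w (s≤s 1≤w) → ℕ.*-mono-≤ 1≤m (ℕ.*-mono-≤ 1≤w 1≤w) }
theorem5 2 1≤m = split-construction triangleFamily-isSplit ℕ.≤-refl
  λ { w (s≤s 2≤w) → ℕ.*-mono-≤ 1≤m (ℕ.*-mono-≤ 2≤w 2≤w) }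
theorem5 3 1≤m = split-construction triangleFamily-isSplit (ℕ.n≤1+n 2)
  λ { w (s≤s 2≤w) → ℕ.*-mono-≤ 1≤m (ℕ.*-mono-≤ 2≤w 2≤w) }
-- Here ⌊ m /2⌋ = suc (suc ⌊ m′ /2⌋).
theorem5 m@(suc (suc (suc (suc m′)))) _ =
  split-construction (Binary.isSplitFamily (suc ⌊ m′ /2⌋)) (⌊n/2⌋*2≤n m) (λ w → 4^-bound (suc ⌊ m′ /2⌋) 4≤m)
  where
  4≤m : 4 ≤ m
  4≤m = s≤s (s≤s (s≤s (s≤s z≤n)))
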